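{- For every $n\ge 1$, the pairs of statistics $(\operatorname{inv},\operatorname{m})$ and $(\operatorname{sor},\operatorname{cyc})$ are equidistributed over $S_n$: \[ \sum_{w\in S_n} q^{\operatorname{inv}(w)} t^{\operatorname{m}(w)} = \sum_{w\in S_n} q^{\operatorname{sor}(w)} t^{\operatorname{cyc}(w)}. \] In particular, $\operatorname{sor}$ has the same distribution over $S_n$ as $\operatorname{inv}$, and $\operatorname{m}$ has the same distribution over $S_n$ as $\operatorname{cyc}$.
   Context: $S_n$ is the symmetric group on $\{1,\ldots,n\}$, permutations written in one-line notation $w=w_1\cdots w_n$, product $(uv)(x)=u(v(x))$. $\operatorname{inv}(w)=|\{(i,j): i<j,\ w_i>w_j\}|$. $\operatorname{m}(w)=|\{ i : w_i < w_j \text{ for all } j>i\}|$ (number of right-to-left minima). $\operatorname{cyc}(w)$ is the number of cycles of $w$. With $t_{ij}=(i\,j)$, every $w$ has a unique factorization $w=t_{i_1j_1}\cdots t_{i_kj_k}$ with $i_s<j_s$ and $j_1<\cdots<j_k$, and $\operatorname{sor}(w)=\sum_{s=1}^k (j_s-i_s)$. -}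

module Defs where

open import Data.Nat using (ℕ; zero; suc; _+_; _∸_; _<_; _≤_; _<?_; _≤?_)
import Data.Nat as ℕ
open import Data.Fin using (Fin; toℕ; fromℕ)
import Data.Fin as F
open import Data.Fin.Properties using () renaming (_≟_ to _≟F_)
open import Data.Vec using (Vec; []; _∷_; lookup; toList)
open import Data.List using (List; []; _∷_; filter; length; map; allFin; concatMap; upTo)
open import Data.List.Relation.Unary.All using (all?)
open import Data.List.Relation.Unary.Unique.Propositional using (Unique)
import Data.List.Relation.Unary.Unique.DecPropositional as UDec
open import Data.Bool using (Bool; true; false; if_then_else_) renaming (_≟_ to _≟B_)
open import Relation.Nullary using (Dec; yes; no; _×-dec_)
open import Relation.Nullary.Decidable using (does)
open import Relation.Binary.PropositionalEquality using (_≡_)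
open import Function using (_∘_)

-- Permutations of {1,…,n}, in one-line notation, shifted to {0,…,n-1}:
-- w = w₁⋯wₙ is the vector (w₁-1, …, wₙ-1) ∈ Fin n ^ n, and S n is the
-- list of all such vectors with pairwise distinct entries (i.e. the
-- injective, hence bijective, maps Fin n → Fin n), each exactly once.

allVecs : (k m : ℕ) → List (Vec (Fin m) k)
allVecs zero    m = [] ∷ []
allVecs (suc k) m = concatMap (λ x → map (x ∷_) (allVecs k m)) (allFin m)

Perm : ℕ → Set
Perm n = Vec (Fin n) n

S : (n : ℕ) → List (Perm n)
S n = filter (λ w → UDec.unique? (_≟F_ {n}) (toList w)) (allVecs n n)

word : ∀ {n} → Perm n → List ℕ
word w = map toℕ (toList w)

invL : List ℕ → ℕ
invL []       = 0
invL (x ∷ xs) = length (filter (λ y → y <? x) xs) + invL xs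

inv : ∀ {n} → Perm n → ℕ
inv w = invL (word w)

rlminL : List ℕ → ℕ
rlminL []       = 0
rlminL (x ∷ xs) = (if does (all? (λ y → x <? y) xs) then 1 else 0) + rlminL xs

m : ∀ {n} → Perm n → ℕ
m w = rlminL (word w)

-- cyc(w) = number of cycles of w, counted by cycle minima:
-- i is the minimum of its cycle iff i ≤ w^k(i) for all 1 ≤ k ≤ n.

app : ∀ {n} → Perm n → Fin n → Fin n
app w i = lookup w i

iter : ∀ {n} → ℕ → Perm n → Fin n → Fin n
iter zero    w i = i
iter (suc k) w i = app w (iter k w i)

isCycleMin : ∀ {n} → Perm n → Fin n → Bool
isCycleMin {n} w i =
  does (all? (λ k → toℕ i ≤? toℕ (iter (suc k) w i)) (upTo n))

cyc : ∀ {n} → Perm n → ℕ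
cyc {n} w = length (filter (λ i → isCycleMin w i ≟B true) (allFin n))

-- Write w = t_{i₁j₁}⋯t_{i_k j_k} with iₛ < jₛ, j₁ < ⋯ < j_k.
-- Then w fixes every x > j_k, and w(i_k) = j_k, so j_k is the largest
-- non-fixed point of w and i_k = w⁻¹(j_k); the remaining factors give the
-- factorization of w·t_{i_k j_k}, which fixes j_k.  Hence sor is computed
-- recursively, scanning the top position j = n, n-1, …, 1:
--   sor(w) = (j - w⁻¹(j)) + sor(w·t_{w⁻¹(j) j} restricted to {1,…,j-1}),
-- where a term with w⁻¹(j) = j contributes 0 (no transposition).
-- In one-line notation, w·t_{ij} swaps the entries at positions i and j.

-- position (0-based) of the first occurrence of v in a list (length if absent)
indexOf : ℕ → List ℕ → ℕ
indexOf v []       = 0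
indexOf v (x ∷ xs) = if does (x ℕ.≟ v) then 0 else suc (indexOf v xs)

replace : ℕ → ℕ → List ℕ → List ℕ
replace v r []       = []
replace v r (x ∷ xs) = (if does (x ℕ.≟ v) then r else x) ∷ replace v r xs


initL : List ℕ → List ℕ
initL []           = []
initL (x ∷ [])     = []
initL (x ∷ y ∷ xs) = x ∷ initL (y ∷ xs)

lastL : List ℕ → ℕ
lastL []           = 0
lastL (x ∷ [])     = x
lastL (x ∷ y ∷ xs) = lastL (y ∷ xs)

-- sorAux k ws : ws is the one-line word (0-based values) of a permutation
-- of {0,…,k-1}; the top value is k-1, sitting at position indexOf (k-1) ws.
sorAux : ℕ → List ℕ → ℕ
sorAux zero    ws = 0
sorAux (suc k) ws =
  (k ∸ indexOf k ws) + sorAux k (replace k (lastL ws) (initL ws))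

sor : ∀ {n} → Perm n → ℕ
sor {n} w = sorAux n (word w)

-- coefficient of q^a t^b in  Σ_{w ∈ S n} q^{f w} t^{g w}
coeff₂ : (n : ℕ) → (Perm n → ℕ) → (Perm n → ℕ) → ℕ → ℕ → ℕ
coeff₂ n f g a b = length (filter (λ w → (f w ℕ.≟ a) ×-dec (g w ℕ.≟ b)) (S n))

coeff₁ : (n : ℕ) → (Perm n → ℕ) → ℕ → ℕ
coeff₁ n f a = length (filter (λ w → f w ℕ.≟ a) (S n))

{-# OPTIONS --safe #-}

-- Both pairs of statistics obey the same recursion in n.  Removing the first letter x of
-- w ∈ S (k+1) and standardising the rest is a bijection S (k+1) ≅ {0,…,k} × S k that adds
-- (x, [x = 0]) to (inv, m).  Removing the last factor t_{q k} of the factorisation defining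
-- sor (or nothing, if w fixes k) is a bijection S (k+1) ≅ ({none} ⊎ {0,…,k-1}) × S k that
-- adds (k - q, 0), resp. (0, 1), to (sor, cyc): inserting k into the cycle of q after q
-- changes neither the cycle count nor the other cycle minima.  The two multisets of
-- increments, {(0,1), (1,0), …, (k,0)} and {(0,1), (k,0), …, (1,0)}, coincide, so by
-- induction (inv, m) and (sor, cyc) have the same joint distribution.

module Submission where

open import Defs
open import Data.Nat using (ℕ; _≤_)
open import Data.Product using (_×_)
open import Relation.Binary.PropositionalEquality using (_≡_)

open import Data.Bool using (true; false; if_then_else_) renaming (_≟_ to _≟B_)
open import Data.Empty using (⊥-elim)
open import Data.Fin using (Fin; zero; suc; toℕ; fromℕ; inject₁; punchIn)
import Data.Fin as Fin
import Data.Fin.Properties as Fin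
open import Data.List
  using (List; []; _∷_; _++_; [_]; filter; length; map; concatMap; cartesianProductWith; allFin; tabulate;
         upTo; applyUpTo; applyDownFrom; reverse)
import Data.List.Properties as List
open import Data.List.Membership.Propositional using (_∈_)
open import Data.List.Membership.Propositional.Properties
  using (∈-∃++; ∈-++⁻; ∈-++⁺ˡ; ∈-++⁺ʳ; ∈-allFin; ∈-cartesianProductWith⁺; ∈-cartesianProductWith⁻;
         ∈-filter⁺; ∈-filter⁻; ∈-map⁻)
open import Data.List.Relation.Binary.Permutation.Propositional
  using (_↭_; ↭-refl; ↭-trans; ↭-sym; ↭-prep; ↭-reflexive; prep; swap)
import Data.List.Relation.Binary.Permutation.Propositional as ↭
open import Data.List.Relation.Binary.Permutation.Propositional.Properties
  using (↭-length; shift; shifts; ++⁺; ++⁺ˡ; filter-↭; ∈-resp-↭)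
import Data.List.Relation.Binary.Permutation.Propositional.Properties as ↭
import Data.List.Relation.Binary.Permutation.Setoid.Properties as PermutationSetoid
open import Data.List.Relation.Binary.Subset.Propositional using (_⊆_)
open import Data.List.Relation.Unary.All as All using (All; []; _∷_; all?)
import Data.List.Relation.Unary.All.Properties as All
open import Data.List.Relation.Unary.AllPairs using ([]; _∷_)
open import Data.List.Relation.Unary.Any using (here; there)
open import Data.List.Relation.Unary.Unique.Propositional using (Unique)
import Data.List.Relation.Unary.Unique.Propositional.Properties as Unique
import Data.List.Relation.Unary.Unique.DecPropositional as UniqueDec
open import Data.Maybe using (Maybe; just; nothing)
import Data.Maybe.Properties as Maybe
open import Data.Nat using (zero; suc; _+_; _∸_; _*_; _<_; _<?_; _≤?_; z≤n; s≤s; s≤s⁻¹)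
import Data.Nat as ℕ
import Data.Nat.Properties as ℕ
open import Data.Nat.DivMod using (_%_; _/_)
import Data.Nat.DivMod as ℕ
open import Data.Product using (∃-syntax; ∃₂; _,_; proj₁; proj₂)
open import Data.Sum using (_⊎_; inj₁; inj₂)
open import Data.Vec using (Vec; []; _∷_; lookup; toList; _∷ʳ_; _[_]≔_)
import Data.Vec as Vec
import Data.Vec.Properties as Vec
open import Data.Vec.Membership.Propositional.Properties using (∈-lookup; ∈-toList⁺)
open import Function using (_∘_; id)
open import Function.Bundles using (_⇔_; mk⇔; Equivalence)
open import Function.Definitions using (Injective)
import Function.Properties.Equivalence as ⇔
open import Level using (0ℓ)
open import Relation.Binary.PropositionalEquality
  using (_≢_; refl; sym; trans; cong; cong₂; subst; subst₂; module ≡-Reasoning)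
import Relation.Binary.PropositionalEquality as ≡
open import Relation.Nullary using (Dec; yes; no; does; contradiction; _×-dec_)
open import Relation.Nullary.Decidable using (does-⇔; dec-true; dec-false)
open import Relation.Unary using (Pred; Decidable)

private
  variable
    A B C : Set

Unique-⊆⇒↭-++ : ∀ {xs ys : List A} → Unique ys → ys ⊆ xs → ∃[ r ] xs ↭ ys ++ r
Unique-⊆⇒↭-++ {xs = xs} {[]} _ _ = xs , ↭-refl
Unique-⊆⇒↭-++ {ys = y ∷ ys} (y∉ys ∷ u) y∷ys⊆xs
  with as , bs , refl ← ∈-∃++ (y∷ys⊆xs (here refl)) =
  let r , p = Unique-⊆⇒↭-++ u ys⊆as++bs in r , ↭-trans (shift y as bs) (↭-prep y p)
  where
  ys⊆as++bs : ys ⊆ as ++ bs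
  ys⊆as++bs {z} z∈ys with ∈-++⁻ as (y∷ys⊆xs (there z∈ys))
  ... | inj₁ z∈as         = ∈-++⁺ˡ z∈as
  ... | inj₂ (here refl)  = ⊥-elim (All.lookup y∉ys z∈ys refl)
  ... | inj₂ (there z∈bs) = ∈-++⁺ʳ as z∈bs

Unique-⊆⇒length≤ : ∀ {xs ys : List A} → Unique ys → ys ⊆ xs → length ys ≤ length xs
Unique-⊆⇒length≤ {ys = ys} u ys⊆xs =
  let _ , p = Unique-⊆⇒↭-++ u ys⊆xs in
  subst (length ys ≤_) (sym (trans (↭-length p) (List.length-++ ys))) (ℕ.m≤m+n _ _)

Unique-⊆-length⇒↭ : ∀ {xs ys : List A} → Unique ys → ys ⊆ xs → length xs ≤ length ys → xs ↭ ys
Unique-⊆-length⇒↭ {xs = xs} {ys} u ys⊆xs len with Unique-⊆⇒↭-++ u ys⊆xs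
... | [] , p = ↭-trans p (↭-reflexive (List.++-identityʳ ys))
... | _ ∷ r , p = contradiction len (ℕ.<⇒≱ (begin-strict
  length ys                ≤⟨ ℕ.m≤m+n (length ys) (length r) ⟩
  length ys + length r     <⟨ ℕ.+-monoʳ-< (length ys) (ℕ.n<1+n (length r)) ⟩
  length ys + suc (length r) ≡⟨ List.length-++ ys ⟨
  length (ys ++ _ ∷ r)     ≡⟨ ↭-length p ⟨
  length xs                ∎))
  where open ℕ.≤-Reasoning

Unique-⊆-⊇⇒↭ : ∀ {xs ys : List A} → Unique xs → Unique ys → xs ⊆ ys → ys ⊆ xs → xs ↭ ys
Unique-⊆-⊇⇒↭ ux uy xs⊆ys ys⊆xs = Unique-⊆-length⇒↭ uy ys⊆xs (Unique-⊆⇒length≤ ux xs⊆ys)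

module _ {P Q : Pred A 0ℓ} (P? : Decidable P) (Q? : Decidable Q) where

  length-filter-cong : (∀ x → does (P? x) ≡ does (Q? x)) →
                       ∀ xs → length (filter P? xs) ≡ length (filter Q? xs)
  length-filter-cong eq [] = refl
  length-filter-cong eq (x ∷ xs) with does (P? x) | does (Q? x) | eq x
  ... | true  | true  | _ = cong suc (length-filter-cong eq xs)
  ... | false | false | _ = length-filter-cong eq xs

length-filter-map : ∀ {P : Pred B 0ℓ} (P? : Decidable P) (f : A → B) xs →
                    length (filter (P? ∘ f) xs) ≡ length (filter P? (map f xs))
length-filter-map P? f [] = refl
length-filter-map P? f (x ∷ xs) with does (P? (f x))
... | true  = cong suc (length-filter-map P? f xs)
... | false = length-filter-map P? f xs

length-filter-↭ : ∀ {P : Pred A 0ℓ} (P? : Decidable P) {xs ys} → xs ↭ ys →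
                  length (filter P? xs) ≡ length (filter P? ys)
length-filter-↭ P? = ↭-length ∘ filter-↭ P?

length-cartesianProductWith : ∀ (f : A → B → C) xs ys →
  length (cartesianProductWith f xs ys) ≡ length xs * length ys
length-cartesianProductWith f [] ys = refl
length-cartesianProductWith f (x ∷ xs) ys = begin
  length (map (f x) ys ++ cartesianProductWith f xs ys)    ≡⟨ List.length-++ (map (f x) ys) ⟩
  length (map (f x) ys) + length (cartesianProductWith f xs ys)
    ≡⟨ cong₂ _+_ (List.length-map (f x) ys) (length-cartesianProductWith f xs ys) ⟩
  length ys + length xs * length ys                         ∎
  where open ≡-Reasoning

-- A list L stands for Σ_{(a,b) ∈ L} qᵃ tᵇ; then _⊗_ is the product of polynomials.

q^_ : ℕ → ℕ × ℕ
q^ a = a , 0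

_⊕_ : ℕ × ℕ → ℕ × ℕ → ℕ × ℕ
(a , b) ⊕ (c , d) = a + c , b + d

_⊗_ : List (ℕ × ℕ) → List (ℕ × ℕ) → List (ℕ × ℕ)
_⊗_ = cartesianProductWith _⊕_

⊗-congʳ : ∀ G {E E'} → E ↭ E' → G ⊗ E ↭ G ⊗ E'
⊗-congʳ [] p = ↭-refl
⊗-congʳ (g ∷ G) p = ++⁺ (↭.map⁺ (g ⊕_) p) (⊗-congʳ G p)

⊗-congˡ : ∀ {G G'} E → G ↭ G' → G ⊗ E ↭ G' ⊗ E
⊗-congˡ E ↭.refl = ↭-refl
⊗-congˡ E (prep g p) = ++⁺ˡ (map (g ⊕_) E) (⊗-congˡ E p)
⊗-congˡ E (swap g h p) = ↭-trans (shifts (map (g ⊕_) E) (map (h ⊕_) E))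
  (++⁺ˡ (map (h ⊕_) E) (++⁺ˡ (map (g ⊕_) E) (⊗-congˡ E p)))
⊗-congˡ E (↭.trans p q) = ↭-trans (⊗-congˡ E p) (⊗-congˡ E q)

⊗-cong : ∀ {G G' E E'} → G ↭ G' → E ↭ E' → G ⊗ E ↭ G' ⊗ E'
⊗-cong {G' = G'} p q = ↭-trans (⊗-congˡ _ p) (⊗-congʳ G' q)

map-cartesianProductWith-⊕ : ∀ (_·_ : C → B → A) (f : A → ℕ × ℕ) (g : C → ℕ × ℕ) (h : B → ℕ × ℕ) →
  ∀ cs bs →
  (∀ c {b} → b ∈ bs → f (c · b) ≡ g c ⊕ h b) →
  map f (cartesianProductWith _·_ cs bs) ≡ map g cs ⊗ map h bs
map-cartesianProductWith-⊕ _·_ f g h [] bs additive = refl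
map-cartesianProductWith-⊕ _·_ f g h (c ∷ cs) bs additive = begin
  map f (map (c ·_) bs ++ cartesianProductWith _·_ cs bs)
    ≡⟨ List.map-++ f (map (c ·_) bs) _ ⟩
  map f (map (c ·_) bs) ++ map f (cartesianProductWith _·_ cs bs)
    ≡⟨ cong₂ _++_ row (map-cartesianProductWith-⊕ _·_ f g h cs bs additive) ⟩
  map (g c ⊕_) (map h bs) ++ map g cs ⊗ map h bs ∎
  where
  open ≡-Reasoning
  row : map f (map (c ·_) bs) ≡ map (g c ⊕_) (map h bs)
  row = begin
    map f (map (c ·_) bs)    ≡⟨ List.map-∘ bs ⟨
    map (f ∘ (c ·_)) bs      ≡⟨ List.map-cong-local (All.tabulate (additive c)) ⟩
    map ((g c ⊕_) ∘ h) bs    ≡⟨ List.map-∘ bs ⟩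
    map (g c ⊕_) (map h bs)  ∎

concatMap-map≡cartesianProductWith : ∀ (f : A → B → C) xs ys →
  concatMap (λ x → map (f x) ys) xs ≡ cartesianProductWith f xs ys
concatMap-map≡cartesianProductWith f [] ys = refl
concatMap-map≡cartesianProductWith f (x ∷ xs) ys =
  cong (map (f x) ys ++_) (concatMap-map≡cartesianProductWith f xs ys)

allVecs-suc : ∀ k m → allVecs (suc k) m ≡ cartesianProductWith _∷_ (allFin m) (allVecs k m)
allVecs-suc k m = concatMap-map≡cartesianProductWith _∷_ (allFin m) (allVecs k m)

allVecs-Unique : ∀ k m → Unique (allVecs k m)
allVecs-Unique zero m = [] ∷ []
allVecs-Unique (suc k) m = subst Unique (sym (allVecs-suc k m))
  (Unique.cartesianProductWith⁺ _∷_ Vec.∷-injective (Unique.allFin⁺ m) (allVecs-Unique k m))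

∈-allVecs : ∀ {k m} (v : Vec (Fin m) k) → v ∈ allVecs k m
∈-allVecs [] = here refl
∈-allVecs {suc k} {m} (x ∷ v) = subst (x ∷ v ∈_) (sym (allVecs-suc k m))
  (∈-cartesianProductWith⁺ _∷_ (∈-allFin x) (∈-allVecs v))

unique? : ∀ {n} (w : Perm n) → Dec (Unique (toList w))
unique? {n} w = UniqueDec.unique? (Fin._≟_ {n}) (toList w)

S-Unique : ∀ n → Unique (S n)
S-Unique n = Unique.filter⁺ unique? (allVecs-Unique n n)

∈-S⁺ : ∀ {n} {w : Perm n} → Unique (toList w) → w ∈ S n
∈-S⁺ {w = w} = ∈-filter⁺ unique? (∈-allVecs w)

∈-S⁻ : ∀ {n} {w : Perm n} → w ∈ S n → Unique (toList w)
∈-S⁻ {n} w∈ = proj₂ (∈-filter⁻ unique? {xs = allVecs n n} w∈)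

LookupInjective : ∀ {k} → Vec A k → Set
LookupInjective w = Injective _≡_ _≡_ (lookup w)

Unique⇒LookupInjective : ∀ {k} (w : Vec A k) → Unique (toList w) → LookupInjective w
Unique⇒LookupInjective (x ∷ w) (x∉w ∷ u) {zero} {zero} eq = refl
Unique⇒LookupInjective (x ∷ w) (x∉w ∷ u) {zero} {suc j} eq =
  ⊥-elim (All.lookup x∉w (∈-toList⁺ (∈-lookup j w)) eq)
Unique⇒LookupInjective (x ∷ w) (x∉w ∷ u) {suc i} {zero} eq =
  ⊥-elim (All.lookup x∉w (∈-toList⁺ (∈-lookup i w)) (sym eq))
Unique⇒LookupInjective (x ∷ w) (x∉w ∷ u) {suc i} {suc j} eq = cong suc (Unique⇒LookupInjective w u eq)

SameOrder : {X : Set} → (X → ℕ) → (X → ℕ) → Set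
SameOrder f g = ∀ a b → (f a < f b) ⇔ (g a < g b)

module _ {X : Set} {f g : X → ℕ} (f≈g : SameOrder f g) where

  invL-map-cong : ∀ xs → invL (map f xs) ≡ invL (map g xs)
  invL-map-cong [] = refl
  invL-map-cong (x ∷ xs) = cong₂ _+_ smaller (invL-map-cong xs)
    where
    smaller : length (filter (_<? f x) (map f xs)) ≡ length (filter (_<? g x) (map g xs))
    smaller = begin
      length (filter (_<? f x) (map f xs))   ≡⟨ length-filter-map (_<? f x) f xs ⟨
      length (filter ((_<? f x) ∘ f) xs)
        ≡⟨ length-filter-cong _ _ (λ y → does-⇔ (f≈g y x) (f y <? f x) (g y <? g x)) xs ⟩
      length (filter ((_<? g x) ∘ g) xs)    ≡⟨ length-filter-map (_<? g x) g xs ⟩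
      length (filter (_<? g x) (map g xs))   ∎
      where open ≡-Reasoning

  rlminL-map-cong : ∀ xs → rlminL (map f xs) ≡ rlminL (map g xs)
  rlminL-map-cong [] = refl
  rlminL-map-cong (x ∷ xs) = cong₂ _+_
    (cong (λ b → if b then 1 else 0) (does-⇔ (allBelow⇔ x) (all? _ _) (all? _ _)))
    (rlminL-map-cong xs)
    where
    allBelow⇔ : ∀ x → All (f x <_) (map f xs) ⇔ All (g x <_) (map g xs)
    allBelow⇔ x = mk⇔ (All.map⁺ ∘ All.map (Equivalence.to (f≈g x _)) ∘ All.map⁻)
                      (All.map⁺ ∘ All.map (Equivalence.from (f≈g x _)) ∘ All.map⁻)

punchIn-SameOrder : ∀ {n} (i : Fin (suc n)) → SameOrder (toℕ ∘ punchIn i) toℕ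
punchIn-SameOrder i a b = mk⇔
  (λ ia<ib → ℕ.≰⇒> λ b≤a → ℕ.<⇒≱ ia<ib (Fin.punchIn-mono-≤ i b a b≤a))
  (λ a<b → ℕ.≰⇒> λ ib≤ia → ℕ.<⇒≱ a<b (Fin.punchIn-cancel-≤ i b a ib≤ia))

punchIn-<-pivot : ∀ {n} (i : Fin (suc n)) j → (toℕ (punchIn i j) < toℕ i) ⇔ (toℕ j < toℕ i)
punchIn-<-pivot zero j = mk⇔ (λ ()) (λ ())
punchIn-<-pivot {suc n} (suc i) zero = mk⇔ id id
punchIn-<-pivot {suc n} (suc i) (suc j) =
  mk⇔ (s≤s ∘ Equivalence.to (punchIn-<-pivot i j) ∘ s≤s⁻¹)
      (s≤s ∘ Equivalence.from (punchIn-<-pivot i j) ∘ s≤s⁻¹)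

length-filter-<-allFin : ∀ k a → a ≤ k → length (filter (λ y → toℕ y <? a) (allFin k)) ≡ a
length-filter-<-allFin k zero _ =
  cong length (List.filter-none (λ y → toℕ y <? 0) {xs = allFin k} (All.tabulate λ _ ()))
length-filter-<-allFin (suc k) (suc a) (s≤s a≤k) = cong suc (begin
  length (filter (λ y → toℕ y <? suc a) (tabulate {n = k} suc))
    ≡⟨ cong (length ∘ filter _) (List.map-tabulate id (Fin.suc {k})) ⟨
  length (filter (λ y → toℕ y <? suc a) (map suc (allFin k)))
    ≡⟨ length-filter-map (λ y → toℕ y <? suc a) (Fin.suc {k}) (allFin k) ⟨
  length (filter (λ y → suc (toℕ y) <? suc a) (allFin k))
    ≡⟨ length-filter-cong _ _ (λ _ → refl) (allFin k) ⟩
  length (filter (λ y → toℕ y <? a) (allFin k))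
    ≡⟨ length-filter-<-allFin k a a≤k ⟩
  a ∎)
  where open ≡-Reasoning

allFin-↭-Unique : ∀ {k} (v : Vec (Fin k) k) → Unique (toList v) → allFin k ↭ toList v
allFin-↭-Unique {k} v u = Unique-⊆-length⇒↭ u (λ {y} _ → ∈-allFin y)
  (ℕ.≤-reflexive (trans (List.length-tabulate id) (sym (Vec.length-toList v))))

-- Removing the first letter

prepend : ∀ {k} → Fin (suc k) → Perm k → Perm (suc k)
prepend x v = x ∷ Vec.map (punchIn x) v

prependWeight : ∀ {k} → Fin (suc k) → ℕ × ℕ
prependWeight zero    = 0 , 1
prependWeight (suc x) = q^ (suc (toℕ x))

invM : ∀ {n} → Perm n → ℕ × ℕ
invM w = inv w , m w

word-prepend : ∀ {k} (x : Fin (suc k)) v →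
               word (prepend x v) ≡ toℕ x ∷ map (toℕ ∘ punchIn x) (toList v)
word-prepend x v = cong (toℕ x ∷_)
  (trans (cong (map toℕ) (Vec.toList-map (punchIn x) v)) (sym (List.map-∘ (toList v))))

inv-prepend : ∀ {k} (x : Fin (suc k)) v → Unique (toList v) → inv (prepend x v) ≡ toℕ x + inv v
inv-prepend {k} x v u = trans (cong invL (word-prepend x v))
  (cong₂ _+_ smaller (invL-map-cong (punchIn-SameOrder x) (toList v)))
  where
  open ≡-Reasoning
  smaller : length (filter (_<? toℕ x) (map (toℕ ∘ punchIn x) (toList v))) ≡ toℕ x
  smaller = begin
    length (filter (_<? toℕ x) (map (toℕ ∘ punchIn x) (toList v)))
      ≡⟨ length-filter-map (_<? toℕ x) (toℕ ∘ punchIn x) (toList v) ⟨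
    length (filter (λ y → toℕ (punchIn x y) <? toℕ x) (toList v))
      ≡⟨ length-filter-cong _ (λ y → toℕ y <? toℕ x)
           (λ y → does-⇔ (punchIn-<-pivot x y) (toℕ (punchIn x y) <? toℕ x) (toℕ y <? toℕ x))
           (toList v) ⟩
    length (filter (λ y → toℕ y <? toℕ x) (toList v))
      ≡⟨ length-filter-↭ (λ y → toℕ y <? toℕ x) (allFin-↭-Unique v u) ⟨
    length (filter (λ y → toℕ y <? toℕ x) (allFin k))
      ≡⟨ length-filter-<-allFin k (toℕ x) (s≤s⁻¹ (Fin.toℕ<n x)) ⟩
    toℕ x ∎

first-letter-rlmin : ∀ {k} (x : Fin (suc k)) (v : Perm k) → Unique (toList v) →
  (if does (all? (toℕ x <?_) (map (toℕ ∘ punchIn x) (toList v))) then 1 else 0) ≡ proj₂ (prependWeight x)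
first-letter-rlmin zero v u = cong (λ b → if b then 1 else 0)
  (dec-true (all? (0 <?_) (map (toℕ ∘ punchIn zero) (toList v))) (All.map⁺ (All.tabulate λ _ → s≤s z≤n)))
first-letter-rlmin {suc k} (suc x) v u = cong (λ b → if b then 1 else 0)
  (dec-false (all? (suc (toℕ x) <?_) (map (toℕ ∘ punchIn (suc x)) (toList v))) λ above →
    ℕ.n≮0 (All.lookup (All.map⁻ above) (∈-resp-↭ (allFin-↭-Unique v u) (here refl))))

m-prepend : ∀ {k} (x : Fin (suc k)) v → Unique (toList v) → m (prepend x v) ≡ proj₂ (prependWeight x) + m v
m-prepend x v u = trans (cong rlminL (word-prepend x v))
  (cong₂ _+_ (first-letter-rlmin x v u) (rlminL-map-cong (punchIn-SameOrder x) (toList v)))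

invM-prepend : ∀ {k} (x : Fin (suc k)) v → Unique (toList v) → invM (prepend x v) ≡ prependWeight x ⊕ invM v
invM-prepend zero    v u = cong₂ _,_ (inv-prepend zero v u) (m-prepend zero v u)
invM-prepend (suc x) v u = cong₂ _,_ (inv-prepend (suc x) v u) (m-prepend (suc x) v u)

toList-injective : ∀ {n} (xs ys : Vec A n) → toList xs ≡ toList ys → xs ≡ ys
toList-injective [] [] _ = refl
toList-injective (x ∷ xs) (y ∷ ys) eq =
  cong₂ _∷_ (List.∷-injectiveˡ eq) (toList-injective xs ys (List.∷-injectiveʳ eq))

prepend-injective : ∀ {k} {x x' : Fin (suc k)} {v v' : Perm k} →
                    prepend x v ≡ prepend x' v' → x ≡ x' × v ≡ v'
prepend-injective {x = x} {v = v} {v'} eq with refl , tails ← Vec.∷-injective eq =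
  refl , toList-injective v v' (List.map-injective (Fin.punchIn-injective x _ _) (begin
    map (punchIn x) (toList v)   ≡⟨ Vec.toList-map (punchIn x) v ⟨
    toList (Vec.map (punchIn x) v) ≡⟨ cong toList tails ⟩
    toList (Vec.map (punchIn x) v') ≡⟨ Vec.toList-map (punchIn x) v' ⟩
    map (punchIn x) (toList v')  ∎))
  where open ≡-Reasoning

prepend-Unique : ∀ {k} (x : Fin (suc k)) v → Unique (toList v) → Unique (toList (prepend x v))
prepend-Unique x v u = subst (Unique ∘ (x ∷_)) (sym (Vec.toList-map (punchIn x) v))
  (All.tabulate x∉ ∷ Unique.map⁺ (Fin.punchIn-injective x _ _) u)
  where
  x∉ : ∀ {y} → y ∈ map (punchIn x) (toList v) → x ≢ y
  x∉ y∈ refl with _ , _ , eq ← ∈-map⁻ (punchIn x) y∈ = Fin.punchInᵢ≢i x _ (sym eq)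

punchOutAll : ∀ {k j} {x : Fin (suc k)} (ys : Vec (Fin (suc k)) j) → All (x ≢_) (toList ys) → Vec (Fin k) j
punchOutAll [] [] = []
punchOutAll (y ∷ ys) (x≢y ∷ x∉ys) = Fin.punchOut x≢y ∷ punchOutAll ys x∉ys

map-punchIn-punchOutAll : ∀ {k j} {x : Fin (suc k)} (ys : Vec (Fin (suc k)) j)
                          (x∉ys : All (x ≢_) (toList ys)) → Vec.map (punchIn x) (punchOutAll ys x∉ys) ≡ ys
map-punchIn-punchOutAll [] [] = refl
map-punchIn-punchOutAll (y ∷ ys) (x≢y ∷ x∉ys) =
  cong₂ _∷_ (Fin.punchIn-punchOut x≢y) (map-punchIn-punchOutAll ys x∉ys)

∈-S-suc⁻ : ∀ {k} {w : Perm (suc k)} → w ∈ S (suc k) → ∃₂ λ x v → v ∈ S k × w ≡ prepend x v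
∈-S-suc⁻ {w = x ∷ ys} w∈ with x∉ys ∷ u ← ∈-S⁻ w∈ =
  x , v , ∈-S⁺ (Unique.map⁻ (subst Unique ys≡ u)) , cong (x ∷_) (sym w≡)
  where
  v = punchOutAll ys x∉ys
  w≡ = map-punchIn-punchOutAll ys x∉ys
  ys≡ = trans (cong toList (sym w≡)) (Vec.toList-map (punchIn x) v)

S-suc-↭-prepend : ∀ k → S (suc k) ↭ cartesianProductWith prepend (allFin (suc k)) (S k)
S-suc-↭-prepend k = Unique-⊆-⊇⇒↭ (S-Unique (suc k))
  (Unique.cartesianProductWith⁺ prepend prepend-injective (Unique.allFin⁺ (suc k)) (S-Unique k)) sub sup
  where
  sub : S (suc k) ⊆ cartesianProductWith prepend (allFin (suc k)) (S k)
  sub w∈ with x , v , v∈ , refl ← ∈-S-suc⁻ w∈ = ∈-cartesianProductWith⁺ prepend (∈-allFin x) v∈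
  sup : cartesianProductWith prepend (allFin (suc k)) (S k) ⊆ S (suc k)
  sup w∈ with x , v , _ , v∈ , refl ← ∈-cartesianProductWith⁻ prepend (allFin (suc k)) (S k) w∈ =
    ∈-S⁺ (prepend-Unique x v (∈-S⁻ v∈))

invM-S-suc : ∀ k → map invM (S (suc k)) ↭ map prependWeight (allFin (suc k)) ⊗ map invM (S k)
invM-S-suc k = ↭-trans (↭.map⁺ invM (S-suc-↭-prepend k)) (↭-reflexive
  (map-cartesianProductWith-⊕ prepend invM prependWeight invM (allFin (suc k)) (S k)
    (λ x v∈ → invM-prepend x _ (∈-S⁻ v∈))))

-- Removing the last transposition

-- insertTop (just q) v is v · t_{q k}: k is written at position q and the displaced
-- letter v q is moved to the end; insertTop nothing v fixes k.  One step of the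
-- recursion defining sor strips exactly this off again.

insertTop : ∀ {k} → Maybe (Fin k) → Perm k → Perm (suc k)
insertTop {k} nothing  v = Vec.map inject₁ v ∷ʳ fromℕ k
insertTop {k} (just q) v = (Vec.map inject₁ v [ q ]≔ fromℕ k) ∷ʳ inject₁ (lookup v q)

topPosition : ∀ {k} → Maybe (Fin k) → ℕ
topPosition {k} nothing = k
topPosition (just q)    = toℕ q

insertTopWeight : ∀ {k} → Maybe (Fin k) → ℕ × ℕ
insertTopWeight nothing      = 0 , 1
insertTopWeight {k} (just q) = q^ (k ∸ toℕ q)

sorCyc : ∀ {n} → Perm n → ℕ × ℕ
sorCyc w = sor w , cyc w

removeTop : ℕ → List ℕ → List ℕ
removeTop k ws = replace k (lastL ws) (initL ws)

toℕs : ∀ {m n} → Vec (Fin m) n → List ℕ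
toℕs = map toℕ ∘ toList

toℕs-∷ʳ : ∀ {m n} (xs : Vec (Fin m) n) y → toℕs (xs ∷ʳ y) ≡ toℕs xs ++ [ toℕ y ]
toℕs-∷ʳ xs y = trans (cong (map toℕ) (Vec.toList-∷ʳ y xs)) (List.map-++ toℕ (toList xs) _)

toℕs-inject₁ : ∀ {m n} (xs : Vec (Fin m) n) → toℕs (Vec.map inject₁ xs) ≡ toℕs xs
toℕs-inject₁ [] = refl
toℕs-inject₁ (x ∷ xs) = cong₂ _∷_ (Fin.toℕ-inject₁ x) (toℕs-inject₁ xs)

toℕs-< : ∀ {m n} (xs : Vec (Fin m) n) → All (_< m) (toℕs xs)
toℕs-< [] = []
toℕs-< (x ∷ xs) = Fin.toℕ<n x ∷ toℕs-< xs

length-toℕs : ∀ {m n} (xs : Vec (Fin m) n) → length (toℕs xs) ≡ n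
length-toℕs xs = trans (List.length-map toℕ (toList xs)) (Vec.length-toList xs)

≢⇒does-≟-false : ∀ {a k} → a < k → does (a ℕ.≟ k) ≡ false
≢⇒does-≟-false {a} {k} a<k = dec-false (a ℕ.≟ k) (ℕ.<⇒≢ a<k)

does-≟-refl : ∀ k → does (k ℕ.≟ k) ≡ true
does-≟-refl k = dec-true (k ℕ.≟ k) refl

indexOf-++-below : ∀ {k} L r → All (_< k) L → indexOf k (L ++ r) ≡ length L + indexOf k r
indexOf-++-below [] r [] = refl
indexOf-++-below (x ∷ L) r (x<k ∷ L<k) rewrite ≢⇒does-≟-false x<k =
  cong suc (indexOf-++-below L r L<k)

replace-below : ∀ {k} r L → All (_< k) L → replace k r L ≡ L
replace-below r [] [] = refl
replace-below r (x ∷ L) (x<k ∷ L<k) rewrite ≢⇒does-≟-false x<k = cong (x ∷_) (replace-below r L L<k)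

removeTop-∷ʳ : ∀ k L z → removeTop k (L ++ [ z ]) ≡ replace k z L
removeTop-∷ʳ k L z = cong₂ (replace k) (lastL-∷ʳ L) (initL-∷ʳ L)
  where
  lastL-∷ʳ : ∀ L → lastL (L ++ [ z ]) ≡ z
  lastL-∷ʳ [] = refl
  lastL-∷ʳ (a ∷ []) = refl
  lastL-∷ʳ (a ∷ b ∷ L) = lastL-∷ʳ (b ∷ L)
  initL-∷ʳ : ∀ L → initL (L ++ [ z ]) ≡ L
  initL-∷ʳ [] = refl
  initL-∷ʳ (a ∷ []) = refl
  initL-∷ʳ (a ∷ b ∷ L) = cong (a ∷_) (initL-∷ʳ (b ∷ L))

indexOf-update-top : ∀ {k n} (xs : Vec (Fin k) n) q r →
                     indexOf k (toℕs (Vec.map inject₁ xs [ q ]≔ fromℕ k) ++ r) ≡ toℕ q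
indexOf-update-top {k} (y ∷ ys) zero r rewrite Fin.toℕ-fromℕ k | does-≟-refl k = refl
indexOf-update-top {k} (y ∷ ys) (suc q) r rewrite Fin.toℕ-inject₁ y | ≢⇒does-≟-false (Fin.toℕ<n y) =
  cong suc (indexOf-update-top ys q r)

replace-update-top : ∀ {k n} (xs : Vec (Fin k) n) q →
                     replace k (toℕ (lookup xs q)) (toℕs (Vec.map inject₁ xs [ q ]≔ fromℕ k)) ≡ toℕs xs
replace-update-top {k} (y ∷ ys) zero rewrite Fin.toℕ-fromℕ k | does-≟-refl k =
  cong (toℕ y ∷_) (trans (cong (replace k (toℕ y)) (toℕs-inject₁ ys))
                         (replace-below (toℕ y) (toℕs ys) (toℕs-< ys)))
replace-update-top {k} (y ∷ ys) (suc q) rewrite Fin.toℕ-inject₁ y | ≢⇒does-≟-false (Fin.toℕ<n y) =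
  cong (toℕ y ∷_) (replace-update-top ys q)

word-insertTop-nothing : ∀ {k} (v : Perm k) → word (insertTop nothing v) ≡ word v ++ [ k ]
word-insertTop-nothing {k} v = trans (toℕs-∷ʳ (Vec.map inject₁ v) (fromℕ k))
  (cong₂ (λ L z → L ++ [ z ]) (toℕs-inject₁ v) (Fin.toℕ-fromℕ k))

word-insertTop-just : ∀ {k} q (v : Perm k) → word (insertTop (just q) v) ≡
  toℕs (Vec.map inject₁ v [ q ]≔ fromℕ k) ++ [ toℕ (lookup v q) ]
word-insertTop-just {k} q v = trans (toℕs-∷ʳ (Vec.map inject₁ v [ q ]≔ fromℕ k) _)
  (cong (λ z → toℕs (Vec.map inject₁ v [ q ]≔ fromℕ k) ++ [ z ]) (Fin.toℕ-inject₁ (lookup v q)))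

indexOf-insertTop : ∀ {k} c (v : Perm k) → indexOf k (word (insertTop c v)) ≡ topPosition c
indexOf-insertTop {k} nothing v rewrite word-insertTop-nothing v
  | indexOf-++-below (word v) [ k ] (toℕs-< v) | does-≟-refl k =
  trans (ℕ.+-identityʳ _) (length-toℕs v)
indexOf-insertTop (just q) v rewrite word-insertTop-just q v = indexOf-update-top v q _

removeTop-insertTop : ∀ {k} c (v : Perm k) → removeTop k (word (insertTop c v)) ≡ word v
removeTop-insertTop {k} nothing v rewrite word-insertTop-nothing v | removeTop-∷ʳ k (word v) k =
  replace-below k (word v) (toℕs-< v)
removeTop-insertTop {k} (just q) v rewrite word-insertTop-just q v
  | removeTop-∷ʳ k (toℕs (Vec.map inject₁ v [ q ]≔ fromℕ k)) (toℕ (lookup v q)) =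
  replace-update-top v q

sor-insertTop : ∀ {k} c (v : Perm k) → sor (insertTop c v) ≡ (k ∸ topPosition c) + sor v
sor-insertTop {k} c v =
  cong₂ _+_ (cong (k ∸_) (indexOf-insertTop c v)) (cong (sorAux k) (removeTop-insertTop c v))

topPosition-injective : ∀ {k} {c c' : Maybe (Fin k)} → topPosition c ≡ topPosition c' → c ≡ c'
topPosition-injective {c = nothing} {nothing} eq = refl
topPosition-injective {c = nothing} {just q} eq = contradiction (sym eq) (ℕ.<⇒≢ (Fin.toℕ<n q))
topPosition-injective {c = just q} {nothing} eq = contradiction eq (ℕ.<⇒≢ (Fin.toℕ<n q))
topPosition-injective {c = just q} {just q'} eq = cong just (Fin.toℕ-injective eq)

word-injective : ∀ {k} {v v' : Perm k} → word v ≡ word v' → v ≡ v'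
word-injective {v = v} {v'} eq = toList-injective v v' (List.map-injective Fin.toℕ-injective eq)

insertTop-injective : ∀ {k} {c c' : Maybe (Fin k)} {v v' : Perm k} →
                      insertTop c v ≡ insertTop c' v' → c ≡ c' × v ≡ v'
insertTop-injective {k} {c} {c'} {v} {v'} eq =
  topPosition-injective (begin
    topPosition c                         ≡⟨ indexOf-insertTop c v ⟨
    indexOf k (word (insertTop c v))      ≡⟨ cong (indexOf k ∘ word) eq ⟩
    indexOf k (word (insertTop c' v'))    ≡⟨ indexOf-insertTop c' v' ⟩
    topPosition c'                        ∎) ,
  word-injective (begin
    word v                                ≡⟨ removeTop-insertTop c v ⟨
    removeTop k (word (insertTop c v))    ≡⟨ cong (removeTop k ∘ word) eq ⟩
    removeTop k (word (insertTop c' v'))  ≡⟨ removeTop-insertTop c' v' ⟩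
    word v'                               ∎)
  where open ≡-Reasoning

toList-∷ʳ-↭ : ∀ {n} (xs : Vec A n) y → toList (xs ∷ʳ y) ↭ y ∷ toList xs
toList-∷ʳ-↭ xs y = ↭-trans (↭-reflexive (Vec.toList-∷ʳ y xs)) (↭.++-comm (toList xs) [ y ])

toList-update-∷ʳ-↭ : ∀ {n} (xs : Vec A n) q y → toList ((xs [ q ]≔ y) ∷ʳ lookup xs q) ↭ y ∷ toList xs
toList-update-∷ʳ-↭ (x ∷ xs) zero y = ↭-prep y (toList-∷ʳ-↭ xs x)
toList-update-∷ʳ-↭ (x ∷ xs) (suc q) y = ↭-trans (↭-prep x (toList-update-∷ʳ-↭ xs q y)) (↭.swap x y ↭-refl)

toList-insertTop-↭ : ∀ {k} c (v : Perm k) → toList (insertTop c v) ↭ fromℕ k ∷ map inject₁ (toList v)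
toList-insertTop-↭ {k} c v =
  ↭-trans (toList-insertTop-↭′ c) (↭-reflexive (cong (fromℕ k ∷_) (Vec.toList-map inject₁ v)))
  where
  toList-insertTop-↭′ : ∀ c → toList (insertTop c v) ↭ fromℕ k ∷ toList (Vec.map inject₁ v)
  toList-insertTop-↭′ nothing = toList-∷ʳ-↭ (Vec.map inject₁ v) (fromℕ k)
  toList-insertTop-↭′ (just q) = subst (λ z → toList ((Vec.map inject₁ v [ q ]≔ fromℕ k) ∷ʳ z) ↭ _)
    (Vec.lookup-map q inject₁ v) (toList-update-∷ʳ-↭ (Vec.map inject₁ v) q (fromℕ k))

Unique-resp-↭ : ∀ {xs ys : List A} → xs ↭ ys → Unique xs → Unique ys
Unique-resp-↭ {A = A} p = PermutationSetoid.Unique-resp-↭ (≡.setoid A) (↭.↭⇒↭ₛ p)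

insertTop-Unique : ∀ {k} c (v : Perm k) → Unique (toList v) → Unique (toList (insertTop c v))
insertTop-Unique {k} c v u = Unique-resp-↭ (↭-sym (toList-insertTop-↭ c v))
  (All.tabulate top∉ ∷ Unique.map⁺ Fin.inject₁-injective u)
  where
  top∉ : ∀ {y} → y ∈ map inject₁ (toList v) → fromℕ k ≢ y
  top∉ y∈ refl with _ , _ , eq ← ∈-map⁻ inject₁ y∈ = Fin.fromℕ≢inject₁ eq

allMaybeFin : ∀ k → List (Maybe (Fin k))
allMaybeFin k = nothing ∷ map just (allFin k)

allMaybeFin-Unique : ∀ k → Unique (allMaybeFin k)
allMaybeFin-Unique k = All.tabulate nothing∉ ∷ Unique.map⁺ Maybe.just-injective (Unique.allFin⁺ k)
  where
  nothing∉ : ∀ {c} → c ∈ map just (allFin k) → nothing ≢ c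
  nothing∉ c∈ refl with _ , _ , () ← ∈-map⁻ just c∈

length-allMaybeFin : ∀ k → length (allMaybeFin k) ≡ length (allFin (suc k))
length-allMaybeFin k = begin
  suc (length (map just (allFin k)))   ≡⟨ cong suc (List.length-map just (allFin k)) ⟩
  suc (length (allFin k))              ≡⟨ cong suc (List.length-tabulate id) ⟩
  suc k                                ≡⟨ List.length-tabulate id ⟨
  length (allFin (suc k))              ∎
  where open ≡-Reasoning

S-suc-↭-insertTop : ∀ k → S (suc k) ↭ cartesianProductWith insertTop (allMaybeFin k) (S k)
S-suc-↭-insertTop k = Unique-⊆-length⇒↭
  (Unique.cartesianProductWith⁺ insertTop insertTop-injective (allMaybeFin-Unique k) (S-Unique k))
  sub (ℕ.≤-reflexive (begin
    length (S (suc k))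
      ≡⟨ ↭-length (S-suc-↭-prepend k) ⟩
    length (cartesianProductWith prepend (allFin (suc k)) (S k))
      ≡⟨ length-cartesianProductWith prepend (allFin (suc k)) (S k) ⟩
    length (allFin (suc k)) * length (S k)
      ≡⟨ cong (_* length (S k)) (length-allMaybeFin k) ⟨
    length (allMaybeFin k) * length (S k)
      ≡⟨ length-cartesianProductWith insertTop (allMaybeFin k) (S k) ⟨
    length (cartesianProductWith insertTop (allMaybeFin k) (S k)) ∎))
  where
  open ≡-Reasoning
  sub : cartesianProductWith insertTop (allMaybeFin k) (S k) ⊆ S (suc k)
  sub w∈ with c , v , _ , v∈ , refl ← ∈-cartesianProductWith⁻ insertTop (allMaybeFin k) (S k) w∈ =
    ∈-S⁺ (insertTop-Unique c v (∈-S⁻ v∈))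

-- Cycle minima

IsCycleMin : ∀ {n} → Perm n → Fin n → Set
IsCycleMin w i = ∀ j → toℕ i ≤ toℕ (iter (suc j) w i)

iterate-above? : ∀ {n} (w : Perm n) i j → Dec (toℕ i ≤ toℕ (iter (suc j) w i))
iterate-above? w i j = toℕ i ≤? toℕ (iter (suc j) w i)

module _ {n} (w : Perm n) where

  iter-+ : ∀ e d x → iter (e + d) w x ≡ iter e w (iter d w x)
  iter-+ zero d x = refl
  iter-+ (suc e) d x = cong (lookup w) (iter-+ e d x)

  iter-injective : LookupInjective w → ∀ a → Injective _≡_ _≡_ (iter a w)
  iter-injective inj zero eq = eq
  iter-injective inj (suc a) eq = iter-injective inj a (inj eq)

  iter-period : LookupInjective w → ∀ x → ∃[ d ] suc d ≤ n × iter (suc d) w x ≡ x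
  iter-period inj x
    with a , b , a<b , eq ← Fin.pigeonhole (ℕ.n<1+n n) (λ (a : Fin (suc n)) → iter (toℕ a) w x)
    with d , a+d≡b ← ℕ.m≤n⇒∃[o]m+o≡n a<b = d , bound , sym (iter-injective inj (toℕ a) (begin
      iter (toℕ a) w x                  ≡⟨ eq ⟩
      iter (toℕ b) w x                  ≡⟨ cong (λ e → iter e w x) (trans (sym a+d≡b) (sym (ℕ.+-suc (toℕ a) d))) ⟩
      iter (toℕ a + suc d) w x          ≡⟨ iter-+ (toℕ a) (suc d) x ⟩
      iter (toℕ a) w (iter (suc d) w x) ∎))
    where
    open ≡-Reasoning
    bound : suc d ≤ n
    bound = ℕ.≤-trans (ℕ.m≤n+m (suc d) (toℕ a))
      (ℕ.≤-trans (ℕ.≤-reflexive (trans (ℕ.+-suc (toℕ a) d) a+d≡b)) (s≤s⁻¹ (Fin.toℕ<n b)))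

  iter-periodic : ∀ {d x} → iter d w x ≡ x → ∀ e q → iter (e + q * d) w x ≡ iter e w x
  iter-periodic {d} {x} period e zero = cong (λ e′ → iter e′ w x) (ℕ.+-identityʳ e)
  iter-periodic {d} {x} period e (suc q) = begin
    iter (e + (d + q * d)) w x
      ≡⟨ cong (λ e′ → iter e′ w x) (trans (ℕ.+-assoc e (q * d) d) (cong (e +_) (ℕ.+-comm (q * d) d))) ⟨
    iter (e + q * d + d) w x    ≡⟨ iter-+ (e + q * d) d x ⟩
    iter (e + q * d) w (iter d w x) ≡⟨ cong (iter (e + q * d) w) period ⟩
    iter (e + q * d) w x        ≡⟨ iter-periodic period e q ⟩
    iter e w x                  ∎
    where open ≡-Reasoning

  -- isCycleMin inspects only n iterates; by periodicity these are all of them.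
  All-upTo⇔IsCycleMin : LookupInjective w → ∀ i →
    All (λ j → toℕ i ≤ toℕ (iter (suc j) w i)) (upTo n) ⇔ IsCycleMin w i
  All-upTo⇔IsCycleMin inj i = mk⇔ from-bounded (All.applyUpTo⁺₂ id n)
    where
    from-bounded : All (λ j → toℕ i ≤ toℕ (iter (suc j) w i)) (upTo n) → IsCycleMin w i
    from-bounded bounded j with d , d<n , period ← iter-period inj i =
      subst (λ e → toℕ i ≤ toℕ e) reduce
        (All.applyUpTo⁻ id n bounded (ℕ.<-≤-trans (ℕ.m%n<n j (suc d)) d<n))
      where
      reduce : iter (suc (j % suc d)) w i ≡ iter (suc j) w i
      reduce = trans (sym (iter-periodic period (suc (j % suc d)) (j / suc d)))
                     (cong (λ e → iter (suc e) w i) (sym (ℕ.m≡m%n+[m/n]*n j (suc d))))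

isCycleMin-cong : ∀ {n m} {w : Perm n} {v : Perm m} {i j} → LookupInjective w → LookupInjective v →
                  IsCycleMin w i ⇔ IsCycleMin v j → isCycleMin w i ≡ isCycleMin v j
isCycleMin-cong {w = w} {v} {i} {j} injw injv w⇔v = does-⇔
  (⇔.trans (All-upTo⇔IsCycleMin w injw i) (⇔.trans w⇔v (⇔.sym (All-upTo⇔IsCycleMin v injv j))))
  (all? (iterate-above? w i) _) (all? (iterate-above? v j) _)

IsCycleMin⇒≤-iter : ∀ {n} {w : Perm n} {i} → IsCycleMin w i → ∀ j → toℕ i ≤ toℕ (iter j w i)
IsCycleMin⇒≤-iter min zero = ℕ.≤-refl
IsCycleMin⇒≤-iter min (suc j) = min j

IsCycleMin-⇔ : ∀ {n m} {w : Perm n} {v : Perm m} {i a} →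
               (∀ j → toℕ (iter j w i) ≡ toℕ (iter j v a)) → IsCycleMin w i ⇔ IsCycleMin v a
IsCycleMin-⇔ same = mk⇔ (λ min j → subst₂ _≤_ (same 0) (same (suc j)) (min j))
                        (λ min j → subst₂ _≤_ (sym (same 0)) (sym (same (suc j))) (min j))

lookup-∷ʳ-inject₁ : ∀ {n} (xs : Vec A n) y i → lookup (xs ∷ʳ y) (inject₁ i) ≡ lookup xs i
lookup-∷ʳ-inject₁ (x ∷ xs) y zero = refl
lookup-∷ʳ-inject₁ (x ∷ xs) y (suc i) = lookup-∷ʳ-inject₁ xs y i

lookup-∷ʳ-fromℕ : ∀ {n} (xs : Vec A n) y → lookup (xs ∷ʳ y) (fromℕ n) ≡ y
lookup-∷ʳ-fromℕ [] y = refl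
lookup-∷ʳ-fromℕ (x ∷ xs) y = lookup-∷ʳ-fromℕ xs y

module _ {k} (v : Perm k) where

  iter-insertTop-nothing : ∀ a j → iter j (insertTop nothing v) (inject₁ a) ≡ inject₁ (iter j v a)
  iter-insertTop-nothing a zero = refl
  iter-insertTop-nothing a (suc j) = begin
    lookup w (iter j w (inject₁ a))         ≡⟨ cong (lookup w) (iter-insertTop-nothing a j) ⟩
    lookup w (inject₁ (iter j v a))         ≡⟨ lookup-∷ʳ-inject₁ (Vec.map inject₁ v) (fromℕ k) _ ⟩
    lookup (Vec.map inject₁ v) (iter j v a) ≡⟨ Vec.lookup-map (iter j v a) inject₁ v ⟩
    inject₁ (iter (suc j) v a)              ∎
    where
    open ≡-Reasoning
    w = insertTop nothing v

  iter-insertTop-nothing-top : ∀ j → iter j (insertTop nothing v) (fromℕ k) ≡ fromℕ k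
  iter-insertTop-nothing-top zero = refl
  iter-insertTop-nothing-top (suc j) =
    trans (cong (lookup (insertTop nothing v)) (iter-insertTop-nothing-top j))
          (lookup-∷ʳ-fromℕ (Vec.map inject₁ v) (fromℕ k))

  module _ (q : Fin k) where
    private
      w = insertTop (just q) v
      u = Vec.map inject₁ v [ q ]≔ fromℕ k

    lookup-insertTop-q : lookup w (inject₁ q) ≡ fromℕ k
    lookup-insertTop-q = trans (lookup-∷ʳ-inject₁ u _ q) (Vec.lookup∘update q (Vec.map inject₁ v) (fromℕ k))

    lookup-insertTop-≢q : ∀ {a} → a ≢ q → lookup w (inject₁ a) ≡ inject₁ (lookup v a)
    lookup-insertTop-≢q {a} a≢q = trans (lookup-∷ʳ-inject₁ u _ a)
      (trans (Vec.lookup∘update′ a≢q (Vec.map inject₁ v) (fromℕ k)) (Vec.lookup-map a inject₁ v))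

    lookup-insertTop-top : lookup w (fromℕ k) ≡ inject₁ (lookup v q)
    lookup-insertTop-top = lookup-∷ʳ-fromℕ u _

    lookup-insertTop-q-top : lookup w (lookup w (inject₁ q)) ≡ inject₁ (lookup v q)
    lookup-insertTop-q-top = trans (cong (lookup w) lookup-insertTop-q) lookup-insertTop-top

    -- The w-orbit of a letter below k is its v-orbit with k inserted right after q.
    iter-insertTop-just⁻ : ∀ a j → (∃[ j' ] iter j w (inject₁ a) ≡ inject₁ (iter j' v a))
                                   ⊎ (∃[ j' ] iter j w (inject₁ a) ≡ fromℕ k × iter j' v a ≡ q)
    iter-insertTop-just⁻ a zero = inj₁ (0 , refl)
    iter-insertTop-just⁻ a (suc j) with iter-insertTop-just⁻ a j
    ... | inj₂ (j' , atTop , refl) = inj₁ (suc j' , trans (cong (lookup w) atTop) lookup-insertTop-top)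
    ... | inj₁ (j' , atVj') with iter j' v a Fin.≟ q
    ...   | yes refl = inj₂ (j' , trans (cong (lookup w) atVj') lookup-insertTop-q , refl)
    ...   | no ≢q    = inj₁ (suc j' , trans (cong (lookup w) atVj') (lookup-insertTop-≢q ≢q))

    iter-insertTop-just⁺ : ∀ a j' → ∃[ j ] iter j w (inject₁ a) ≡ inject₁ (iter j' v a)
    iter-insertTop-just⁺ a zero = 0 , refl
    iter-insertTop-just⁺ a (suc j') with j , atVj' ← iter-insertTop-just⁺ a j' with iter j' v a Fin.≟ q
    ... | yes refl = suc (suc j) , trans (cong (lookup w ∘ lookup w) atVj') lookup-insertTop-q-top
    ... | no ≢q    = suc j , trans (cong (lookup w) atVj') (lookup-insertTop-≢q ≢q)

    IsCycleMin-insertTop-just : ∀ a → IsCycleMin w (inject₁ a) ⇔ IsCycleMin v a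
    IsCycleMin-insertTop-just a = mk⇔ to from
      where
      toℕ-a = Fin.toℕ-inject₁ a
      to : IsCycleMin w (inject₁ a) → IsCycleMin v a
      to min j with iter-insertTop-just⁺ a (suc j)
      ... | zero , a≡ = ℕ.≤-reflexive (cong toℕ (Fin.inject₁-injective a≡))
      ... | suc J , at = subst₂ _≤_ toℕ-a (trans (cong toℕ at) (Fin.toℕ-inject₁ _)) (min J)
      from : IsCycleMin v a → IsCycleMin w (inject₁ a)
      from min j with iter-insertTop-just⁻ a (suc j)
      ... | inj₁ (j' , at) = subst₂ _≤_ (sym toℕ-a) (sym (trans (cong toℕ at) (Fin.toℕ-inject₁ _)))
                               (IsCycleMin⇒≤-iter min j')
      ... | inj₂ (_ , atTop , _) = subst₂ _≤_ (sym toℕ-a) (sym (trans (cong toℕ atTop) (Fin.toℕ-fromℕ k)))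
                                     (ℕ.<⇒≤ (Fin.toℕ<n a))

tabulate-∷ʳ : ∀ {k} (f : Fin (suc k) → A) → tabulate f ≡ tabulate (f ∘ inject₁) ++ [ f (fromℕ k) ]
tabulate-∷ʳ {k = zero} f = refl
tabulate-∷ʳ {k = suc k} f = cong (f zero ∷_) (tabulate-∷ʳ (f ∘ suc))

cycleMin? : ∀ {n} (w : Perm n) (i : Fin n) → Dec (isCycleMin w i ≡ true)
cycleMin? w i = isCycleMin w i ≟B true

cyc-split : ∀ {k} (w : Perm (suc k)) →
  cyc w ≡ length (filter (cycleMin? w ∘ inject₁) (allFin k)) + length (filter (cycleMin? w) [ fromℕ k ])
cyc-split {k} w = begin
  length (filter (cycleMin? w) (tabulate id))
    ≡⟨ cong (length ∘ filter (cycleMin? w)) (tabulate-∷ʳ id) ⟩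
  length (filter (cycleMin? w) (tabulate inject₁ ++ [ fromℕ k ]))
    ≡⟨ cong length (List.filter-++ (cycleMin? w) (tabulate inject₁) _) ⟩
  length (filter (cycleMin? w) (tabulate inject₁) ++ filter (cycleMin? w) [ fromℕ k ])
    ≡⟨ List.length-++ (filter (cycleMin? w) (tabulate inject₁)) ⟩
  length (filter (cycleMin? w) (tabulate inject₁)) + length (filter (cycleMin? w) [ fromℕ k ])
    ≡⟨ cong (λ xs → length (filter (cycleMin? w) xs) + top) (List.map-tabulate id inject₁) ⟨
  length (filter (cycleMin? w) (map inject₁ (allFin k))) + length (filter (cycleMin? w) [ fromℕ k ])
    ≡⟨ cong (_+ top) (length-filter-map (cycleMin? w) inject₁ (allFin k)) ⟨
  length (filter (cycleMin? w ∘ inject₁) (allFin k)) + length (filter (cycleMin? w) [ fromℕ k ]) ∎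
  where
  open ≡-Reasoning
  top = length (filter (cycleMin? w) [ fromℕ k ])

module _ {k} (v : Perm k) (u : Unique (toList v)) where
  private
    injective : ∀ c → LookupInjective (insertTop c v)
    injective c = Unique⇒LookupInjective _ (insertTop-Unique c v u)

  isCycleMin-insertTop-below : ∀ c a → isCycleMin (insertTop c v) (inject₁ a) ≡ isCycleMin v a
  isCycleMin-insertTop-below c a =
    isCycleMin-cong {w = insertTop c v} {v} (injective c) (Unique⇒LookupInjective v u) (same c)
    where
    same : ∀ c → IsCycleMin (insertTop c v) (inject₁ a) ⇔ IsCycleMin v a
    same nothing = IsCycleMin-⇔ λ j → trans (cong toℕ (iter-insertTop-nothing v a j)) (Fin.toℕ-inject₁ _)
    same (just q) = IsCycleMin-insertTop-just v q a

  isCycleMin-insertTop-nothing-top : isCycleMin (insertTop nothing v) (fromℕ k) ≡ true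
  isCycleMin-insertTop-nothing-top =
    dec-true (all? (iterate-above? (insertTop nothing v) (fromℕ k)) (upTo (suc k)))
    (Equivalence.from (All-upTo⇔IsCycleMin (insertTop nothing v) (injective nothing) (fromℕ k))
      λ j → ℕ.≤-reflexive (cong toℕ (sym (iter-insertTop-nothing-top v (suc j)))))

  isCycleMin-insertTop-just-top : ∀ q → isCycleMin (insertTop (just q) v) (fromℕ k) ≡ false
  isCycleMin-insertTop-just-top q =
    dec-false (all? (iterate-above? (insertTop (just q) v) (fromℕ k)) (upTo (suc k))) λ where
    (k≤w[k] ∷ _) → ℕ.<⇒≱ (Fin.toℕ<n (lookup v q))
      (subst₂ _≤_ (Fin.toℕ-fromℕ k) (trans (cong toℕ (lookup-insertTop-top v q)) (Fin.toℕ-inject₁ _)) k≤w[k])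

  cyc-insertTop : ∀ c → cyc (insertTop c v) ≡ proj₂ (insertTopWeight c) + cyc v
  cyc-insertTop c = begin
    cyc w
      ≡⟨ cyc-split w ⟩
    length (filter (cycleMin? w ∘ inject₁) (allFin k)) + length (filter (cycleMin? w) [ fromℕ k ])
      ≡⟨ cong₂ _+_ (length-filter-cong _ (cycleMin? v) below (allFin k))
                   (length-filter-map (_≟B true) (isCycleMin w) [ fromℕ k ]) ⟩
    cyc v + length (filter (_≟B true) [ isCycleMin w (fromℕ k) ])
      ≡⟨ topContribution c ⟩
    proj₂ (insertTopWeight c) + cyc v ∎
    where
    open ≡-Reasoning
    w = insertTop c v
    below : ∀ a → does (cycleMin? w (inject₁ a)) ≡ does (cycleMin? v a)
    below a = cong (does ∘ (_≟B true)) (isCycleMin-insertTop-below c a)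
    topContribution : ∀ c → cyc v + length (filter (_≟B true) [ isCycleMin (insertTop c v) (fromℕ k) ])
                            ≡ proj₂ (insertTopWeight c) + cyc v
    topContribution nothing rewrite isCycleMin-insertTop-nothing-top = ℕ.+-comm (cyc v) 1
    topContribution (just q) rewrite isCycleMin-insertTop-just-top q = ℕ.+-identityʳ (cyc v)

sorCyc-insertTop : ∀ {k} c (v : Perm k) → Unique (toList v) → sorCyc (insertTop c v) ≡ insertTopWeight c ⊕ sorCyc v
sorCyc-insertTop {k} c v u =
  cong₂ _,_ (trans (sor-insertTop c v) (cong (_+ sor v) (topWeight c))) (cyc-insertTop v u c)
  where
  topWeight : ∀ c → k ∸ topPosition c ≡ proj₁ (insertTopWeight c)
  topWeight nothing  = ℕ.n∸n≡0 k
  topWeight (just q) = refl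

sorCyc-S-suc : ∀ k → map sorCyc (S (suc k)) ↭ map insertTopWeight (allMaybeFin k) ⊗ map sorCyc (S k)
sorCyc-S-suc k = ↭-trans (↭.map⁺ sorCyc (S-suc-↭-insertTop k)) (↭-reflexive
  (map-cartesianProductWith-⊕ insertTop sorCyc insertTopWeight sorCyc (allMaybeFin k) (S k)
    (λ c v∈ → sorCyc-insertTop c _ (∈-S⁻ v∈))))

tabulate-∘toℕ : ∀ (f : ℕ → A) k → tabulate {n = k} (f ∘ toℕ) ≡ applyUpTo f k
tabulate-∘toℕ f zero = refl
tabulate-∘toℕ f (suc k) = cong (f 0 ∷_) (tabulate-∘toℕ (f ∘ suc) k)

applyUpTo-∸ : ∀ k → applyUpTo (λ i → q^ (k ∸ i)) k ≡ applyDownFrom (λ i → q^ (suc i)) k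
applyUpTo-∸ zero = refl
applyUpTo-∸ (suc k) = cong (q^ (suc k) ∷_) (applyUpTo-∸ k)

prependWeights : ∀ k → map prependWeight (allFin (suc k)) ≡ (0 , 1) ∷ applyUpTo (λ i → q^ (suc i)) k
prependWeights k = cong ((0 , 1) ∷_)
  (trans (List.map-tabulate suc prependWeight) (tabulate-∘toℕ (λ i → q^ (suc i)) k))

insertTopWeights : ∀ k → map insertTopWeight (allMaybeFin k) ≡ (0 , 1) ∷ applyDownFrom (λ i → q^ (suc i)) k
insertTopWeights k = cong ((0 , 1) ∷_) (begin
  map insertTopWeight (map just (allFin k))  ≡⟨ List.map-∘ (allFin k) ⟨
  map (insertTopWeight ∘ just) (allFin k)    ≡⟨ List.map-tabulate id (insertTopWeight ∘ just) ⟩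
  tabulate (λ q → q^ (k ∸ toℕ q))            ≡⟨ tabulate-∘toℕ (λ i → q^ (k ∸ i)) k ⟩
  applyUpTo (λ i → q^ (k ∸ i)) k             ≡⟨ applyUpTo-∸ k ⟩
  applyDownFrom (λ i → q^ (suc i)) k         ∎)
  where open ≡-Reasoning

prependWeights-↭-insertTopWeights : ∀ k →
  map prependWeight (allFin (suc k)) ↭ map insertTopWeight (allMaybeFin k)
prependWeights-↭-insertTopWeights k = begin
  map prependWeight (allFin (suc k))                   ≡⟨ prependWeights k ⟩
  (0 , 1) ∷ applyUpTo (λ i → q^ (suc i)) k             ↭⟨ ↭-prep (0 , 1) (↭.↭-reverse (applyUpTo _ k)) ⟨
  (0 , 1) ∷ reverse (applyUpTo (λ i → q^ (suc i)) k)   ≡⟨ cong ((0 , 1) ∷_) (List.reverse-applyUpTo _ k) ⟩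
  (0 , 1) ∷ applyDownFrom (λ i → q^ (suc i)) k         ≡⟨ insertTopWeights k ⟨
  map insertTopWeight (allMaybeFin k)                  ∎
  where open ↭.PermutationReasoning

invM-↭-sorCyc : ∀ n → map invM (S n) ↭ map sorCyc (S n)
invM-↭-sorCyc zero = ↭-refl
invM-↭-sorCyc (suc k) = begin
  map invM (S (suc k))
    ↭⟨ invM-S-suc k ⟩
  map prependWeight (allFin (suc k)) ⊗ map invM (S k)
    ↭⟨ ⊗-cong (prependWeights-↭-insertTopWeights k) (invM-↭-sorCyc k) ⟩
  map insertTopWeight (allMaybeFin k) ⊗ map sorCyc (S k)
    ↭⟨ sorCyc-S-suc k ⟨
  map sorCyc (S (suc k)) ∎
  where open ↭.PermutationReasoning

count-invM≡count-sorCyc : ∀ n {P : Pred (ℕ × ℕ) 0ℓ} (P? : Decidable P) →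
  length (filter (P? ∘ invM) (S n)) ≡ length (filter (P? ∘ sorCyc) (S n))
count-invM≡count-sorCyc n P? = begin
  length (filter (P? ∘ invM) (S n))        ≡⟨ length-filter-map P? invM (S n) ⟩
  length (filter P? (map invM (S n)))      ≡⟨ length-filter-↭ P? (invM-↭-sorCyc n) ⟩
  length (filter P? (map sorCyc (S n)))    ≡⟨ length-filter-map P? sorCyc (S n) ⟨
  length (filter (P? ∘ sorCyc) (S n))      ∎
  where open ≡-Reasoning

corollary2p5 : (n : ℕ) → 1 ≤ n →
    ((a b : ℕ) → coeff₂ n inv m a b ≡ coeff₂ n sor cyc a b)
    × ((a : ℕ) → coeff₁ n sor a ≡ coeff₁ n inv a)
    × ((b : ℕ) → coeff₁ n m b ≡ coeff₁ n cyc b)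
corollary2p5 n _ =
  (λ a b → count-invM≡count-sorCyc n (λ (x , y) → (x ℕ.≟ a) ×-dec (y ℕ.≟ b))) ,
  (λ a → sym (count-invM≡count-sorCyc n ((ℕ._≟ a) ∘ proj₁))) ,
  (λ b → count-invM≡count-sorCyc n ((ℕ._≟ b) ∘ proj₂))
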